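{- Let $M=(\Sigma_\Box,Q,q_{in},q_{fin},\delta)$ be a Turing machine. There is a term $\mathtt{trans}$ of $\Lambda_{\tt det}$ such that for every continuation $k$ (a value) and every configuration $C$ of $M$: (1) if $C$ is final (its state is $q_{fin}$), then $\mathtt{trans}\; k\; \ulcorner C\urcorner \rightarrow_{det}^{O(1)} k\; \ulcorner C\urcorner$; (2) if $C \to_M D$, then $\mathtt{trans}\; k\; \ulcorner C\urcorner \rightarrow_{det}^{O(1)} \mathtt{trans}\; k\; \ulcorner D\urcorner$.
   Context: $\Lambda_{\tt det}$: terms $t ::= v \mid t\,v$, values $v ::= \lambda x.t \mid x$; evaluation contexts $E ::= [\cdot] \mid E\,v$; reduction $E[(\lambda x.t)s] \rightarrow_{det} E[t\{x:=s\}]$; $\rightarrow_{det}^{O(1)}$ is a reduction whose number of steps is bounded by a constant depending only on $M$ (not on $k$ or $C$). A Turing machine $M$ has a finite alphabet $\Sigma=\{a_1,\dots,a_n\}$ plus a blank symbol $\Box$ (tape alphabet $\Sigma_\Box=\Sigma\cup\{\Box\}$, $\Box$ last in the order), a finite state set $Q=\{q_1,\dots,q_m\}$, initial and final states $q_{in},q_{fin}$, and a partial transition function $\delta$ from $Q\times\Sigma_\Box$ to $Q\times\Sigma_\Box\times\{\leftarrow,\rightarrow,\downarrow\}$ defined exactly on pairs whose state is not $q_{fin}$. A configuration is a quadruple $(s,a,r,q)$: tape left of the head $s$, symbol under the head $a$, tape right of the head $r$, state $q$. Transitions $C\to_M D$ for $C=(s,a_j,r,q_i)$ with $\delta(q_i,a_j)=(q_l,a_h,d)$: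 if $d={\downarrow}$, $D=(s,a_h,r,q_l)$; if $d={\leftarrow}$, $D=(p,a_p,a_h r,q_l)$ when $s=p a_p$ and $D=(\varepsilon,\Box,a_h r,q_l)$ when $s=\varepsilon$; if $d={\rightarrow}$, $D=(s a_h,a_p,p,q_l)$ when $r=a_p p$ and $D=(s a_h,\Box,\varepsilon,q_l)$ when $r=\varepsilon$. Scott encoding for an ordered alphabet $\Delta=\{b_1,\dots,b_n\}$: $\ulcorner b_i\urcorner_\Delta := \lambda x_1.\dots\lambda x_n.x_i$, $\ulcorner \varepsilon\urcorner_{\Delta^*} := \lambda x_1.\dots\lambda x_n.\lambda y.y$, $\ulcorner b_i r\urcorner_{\Delta^*} := \lambda x_1.\dots\lambda x_n.\lambda y.x_i\,\ulcorner r\urcorner_{\Delta^*}$; $Q$ is encoded as an alphabet. Configurations: $\ulcorner (s,a,r,q)\urcorner := \lambda x.\, x\,\ulcorner s^r\urcorner_{\Sigma_\Box^*}\,\ulcorner a\urcorner_{\Sigma_\Box}\,\ulcorner r\urcorner_{\Sigma_\Box^*}\,\ulcorner q\urcorner_Q$, with $s^r$ the reversal of $s$. -}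

module Defs where

open import Data.Nat using (ℕ; zero; suc; _∸_; _≤_)
open import Data.Fin using (Fin; toℕ; fromℕ)
open import Data.List using (List; []; _∷_; _∷ʳ_; reverse)
open import Data.Product using (_×_; _,_; Σ; ∃)
open import Relation.Binary.PropositionalEquality using (_≡_; _≢_)

mutual
  data Val : Set where
    var : ℕ → Val
    lam : Tm → Val

  data Tm : Set where
    val : Val → Tm
    app : Tm → Val → Tm

ext : (ℕ → ℕ) → ℕ → ℕ
ext ρ zero    = zero
ext ρ (suc x) = suc (ρ x)

mutual
  renV : (ℕ → ℕ) → Val → Val
  renV ρ (var x) = var (ρ x)
  renV ρ (lam t) = lam (renT (ext ρ) t)

  renT : (ℕ → ℕ) → Tm → Tm
  renT ρ (val v)   = val (renV ρ v)
  renT ρ (app t v) = app (renT ρ t) (renV ρ v)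

exts : (ℕ → Val) → ℕ → Val
exts σ zero    = var zero
exts σ (suc x) = renV suc (σ x)

mutual
  subV : (ℕ → Val) → Val → Val
  subV σ (var x) = σ x
  subV σ (lam t) = lam (subT (exts σ) t)

  subT : (ℕ → Val) → Tm → Tm
  subT σ (val v)   = val (subV σ v)
  subT σ (app t v) = app (subT σ t) (subV σ v)

single : Val → ℕ → Val
single s zero    = s
single s (suc x) = var x

_[_] : Tm → Val → Tm
t [ s ] = subT (single s) t

-- E[(λx.t)s] →det E[t{x:=s}] with E ::= [·] | E v
infix 4 _⟶det_
data _⟶det_ : Tm → Tm → Set where
  β   : ∀ {t s} → app (val (lam t)) s ⟶det t [ s ]
  ctx : ∀ {t t' v} → t ⟶det t' → app t v ⟶det app t' v

data _⟶det[_]_ : Tm → ℕ → Tm → Set where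
  done : ∀ {t} → t ⟶det[ 0 ] t
  more : ∀ {t t' u j} → t ⟶det t' → t' ⟶det[ j ] u → t ⟶det[ suc j ] u

_⟶det≤[_]_ : Tm → ℕ → Tm → Set
t ⟶det≤[ c ] u = Σ ℕ λ j → j ≤ c × t ⟶det[ j ] u

data Dir : Set where
  L R S : Dir

-- Σ = Fin n, Σ_□ = Fin (suc n) with □ = fromℕ n the last symbol; Q = Fin m.
-- δ is defined exactly on the non-final states (irrelevant proof argument).
record TM : Set where
  field
    n    : ℕ
    m    : ℕ
    qin  : Fin m
    qfin : Fin m
    δ    : (q : Fin m) → .(q ≢ qfin) → Fin (suc n) → Fin m × Fin (suc n) × Dir

  Sym : Set
  Sym = Fin (suc n)

  □ : Sym
  □ = fromℕ n

  record Config : Set where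
    constructor ⟨_,_,_,_⟩
    field
      left  : List Sym
      head  : Sym
      right : List Sym
      state : Fin m

  infix 4 _→M_
  data _→M_ : Config → Config → Set where
    stay   : ∀ {s a r q l h} .(ne : q ≢ qfin) → δ q ne a ≡ (l , h , S) →
             ⟨ s , a , r , q ⟩ →M ⟨ s , h , r , l ⟩
    left∷  : ∀ {p ap a r q l h} .(ne : q ≢ qfin) → δ q ne a ≡ (l , h , L) →
             ⟨ p ∷ʳ ap , a , r , q ⟩ →M ⟨ p , ap , h ∷ r , l ⟩
    left[] : ∀ {a r q l h} .(ne : q ≢ qfin) → δ q ne a ≡ (l , h , L) →
             ⟨ [] , a , r , q ⟩ →M ⟨ [] , □ , h ∷ r , l ⟩
    right∷ : ∀ {s a ap p q l h} .(ne : q ≢ qfin) → δ q ne a ≡ (l , h , R) →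
             ⟨ s , a , ap ∷ p , q ⟩ →M ⟨ s ∷ʳ h , ap , p , l ⟩
    right[] : ∀ {s a q l h} .(ne : q ≢ qfin) → δ q ne a ≡ (l , h , R) →
             ⟨ s , a , [] , q ⟩ →M ⟨ s ∷ʳ h , □ , [] , l ⟩

lams : ℕ → Tm → Tm
lams zero    t = t
lams (suc k) t = val (lam (lams k t))

-- ⌜b_i⌝ = λx_1…λx_N. x_i   (Fin index i is 0-based, so x_{i+1} = var (N-1-i))
encSym : {N : ℕ} → Fin N → Val
encSym {zero}  ()
encSym {suc N} i = lam (lams N (val (var (N ∸ toℕ i))))

-- ⌜ε⌝ = λx_1…λx_N.λy.y ,  ⌜b_i r⌝ = λx_1…λx_N.λy. x_i ⌜r⌝
encStr : {N : ℕ} → List (Fin N) → Val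
encStr {N} []      = lam (lams N (val (var 0)))
encStr {N} (i ∷ r) = lam (lams N (app (val (var (N ∸ toℕ i))) (encStr r)))

-- ⌜(s,a,r,q)⌝ = λx. x ⌜s^r⌝ ⌜a⌝ ⌜r⌝ ⌜q⌝
encConf : (M : TM) → TM.Config M → Val
encConf M C =
  lam (app (app (app (app (val (var 0)) (encStr (reverse left))) (encSym head))
                 (encStr right)) (encSym state))
  where open TM.Config C

module Submission where

-- The term trans is rec rec: rec receives a copy of itself and hands it on,
-- which gives recursion without a fixed-point combinator.  One machine step
-- is a fixed cascade of Scott case distinctions.  The encoded configuration
-- is applied to a dispatcher; its state selects, from a table indexed by Q,
-- either the halting handler (which passes the configuration to k) or a table
-- indexed by Σ□ on which the head symbol selects the handler for δ(q, a).  For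
-- a move, the tape string on the side the head moves to selects between a
-- cell handler and an end-of-tape handler; the handler rebuilds the encoded
-- successor configuration and calls rec rec k again.  A selection from a
-- table of K entries costs K β-steps, so one machine step costs a number of
-- steps bounded in terms of |Q| and |Σ| alone.  All values passed around are
-- closed, so substitution leaves them untouched and each β-step is computed
-- exactly.

open import Defs
open import Data.Nat using (ℕ; zero; suc; _+_; _∸_; _≤_; _<_; _<ᵇ_; z≤n; s≤s)
open import Data.Nat.Properties
  using ( <⇒<ᵇ; <ᵇ⇒<; ≤-refl; ≤-trans; ≤-<-trans; m∸n≤m; m<m+n; m≤m+n; n≤1+n
        ; +-suc; +-comm; +-∸-assoc; +-monoʳ-<; +-monoʳ-≤)
open import Data.Bool using (T)
open import Data.Unit using (tt)
open import Data.Empty using (⊥-elim; ⊥-elim-irr)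
open import Data.Product using (Σ; _×_; _,_)
open import Data.List using (List; []; _∷_; _∷ʳ_; _++_; map; reverse; length; tabulate)
open import Data.List.Properties
  using (map-++; unfold-reverse; length-reverse; reverse-++; length-tabulate; ++-assoc; length-++)
open import Data.List.Relation.Unary.All using (All; []; _∷_)
open import Data.List.Relation.Unary.All.Properties using (++⁺; tabulate⁺)
open import Data.Fin using (Fin; toℕ) renaming (zero to fzero; suc to fsuc)
open import Data.Fin.Properties using (_≟_; toℕ≤pred[n])
open import Function using (_∘_)
open import Relation.Nullary using (yes; no)
open import Relation.Binary.PropositionalEquality
open ≡-Reasoning

ext-cong : ∀ {ρ ρ′} → ρ ≗ ρ′ → ext ρ ≗ ext ρ′
ext-cong h zero    = refl
ext-cong h (suc x) = cong suc (h x)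

mutual
  renV-cong : ∀ {ρ ρ′} → ρ ≗ ρ′ → renV ρ ≗ renV ρ′
  renV-cong h (var x) = cong var (h x)
  renV-cong h (lam t) = cong lam (renT-cong (ext-cong h) t)

  renT-cong : ∀ {ρ ρ′} → ρ ≗ ρ′ → renT ρ ≗ renT ρ′
  renT-cong h (val v)   = cong val (renV-cong h v)
  renT-cong h (app t v) = cong₂ app (renT-cong h t) (renV-cong h v)

exts-cong : ∀ {σ σ′} → σ ≗ σ′ → exts σ ≗ exts σ′
exts-cong h zero    = refl
exts-cong h (suc x) = cong (renV suc) (h x)

mutual
  subV-cong : ∀ {σ σ′} → σ ≗ σ′ → subV σ ≗ subV σ′
  subV-cong h (var x) = h x
  subV-cong h (lam t) = cong lam (subT-cong (exts-cong h) t)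

  subT-cong : ∀ {σ σ′} → σ ≗ σ′ → subT σ ≗ subT σ′
  subT-cong h (val v)   = cong val (subV-cong h v)
  subT-cong h (app t v) = cong₂ app (subT-cong h t) (subV-cong h v)

ext-∘ : ∀ ρ ρ′ → ext ρ ∘ ext ρ′ ≗ ext (ρ ∘ ρ′)
ext-∘ ρ ρ′ zero    = refl
ext-∘ ρ ρ′ (suc x) = refl

mutual
  renV-renV : ∀ ρ ρ′ v → renV ρ (renV ρ′ v) ≡ renV (ρ ∘ ρ′) v
  renV-renV ρ ρ′ (var x) = refl
  renV-renV ρ ρ′ (lam t) =
    cong lam (trans (renT-renT (ext ρ) (ext ρ′) t) (renT-cong (ext-∘ ρ ρ′) t))

  renT-renT : ∀ ρ ρ′ t → renT ρ (renT ρ′ t) ≡ renT (ρ ∘ ρ′) t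
  renT-renT ρ ρ′ (val v)   = cong val (renV-renV ρ ρ′ v)
  renT-renT ρ ρ′ (app t v) = cong₂ app (renT-renT ρ ρ′ t) (renV-renV ρ ρ′ v)

exts-ext : ∀ σ ρ → exts σ ∘ ext ρ ≗ exts (σ ∘ ρ)
exts-ext σ ρ zero    = refl
exts-ext σ ρ (suc x) = refl

mutual
  subV-renV : ∀ σ ρ v → subV σ (renV ρ v) ≡ subV (σ ∘ ρ) v
  subV-renV σ ρ (var x) = refl
  subV-renV σ ρ (lam t) =
    cong lam (trans (subT-renT (exts σ) (ext ρ) t) (subT-cong (exts-ext σ ρ) t))

  subT-renT : ∀ σ ρ t → subT σ (renT ρ t) ≡ subT (σ ∘ ρ) t
  subT-renT σ ρ (val v)   = cong val (subV-renV σ ρ v)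
  subT-renT σ ρ (app t v) = cong₂ app (subT-renT σ ρ t) (subV-renV σ ρ v)

renV-ext-exts : ∀ ρ σ → renV (ext ρ) ∘ exts σ ≗ exts (renV ρ ∘ σ)
renV-ext-exts ρ σ zero    = refl
renV-ext-exts ρ σ (suc x) =
  trans (renV-renV (ext ρ) suc (σ x)) (sym (renV-renV suc ρ (σ x)))

mutual
  renV-subV : ∀ ρ σ v → renV ρ (subV σ v) ≡ subV (renV ρ ∘ σ) v
  renV-subV ρ σ (var x) = refl
  renV-subV ρ σ (lam t) =
    cong lam (trans (renT-subT (ext ρ) (exts σ) t) (subT-cong (renV-ext-exts ρ σ) t))

  renT-subT : ∀ ρ σ t → renT ρ (subT σ t) ≡ subT (renV ρ ∘ σ) t
  renT-subT ρ σ (val v)   = cong val (renV-subV ρ σ v)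
  renT-subT ρ σ (app t v) = cong₂ app (renT-subT ρ σ t) (renV-subV ρ σ v)

subV-exts-exts : ∀ σ τ → subV (exts σ) ∘ exts τ ≗ exts (subV σ ∘ τ)
subV-exts-exts σ τ zero    = refl
subV-exts-exts σ τ (suc x) =
  trans (subV-renV (exts σ) suc (τ x)) (sym (renV-subV suc σ (τ x)))

mutual
  subV-subV : ∀ σ τ v → subV σ (subV τ v) ≡ subV (subV σ ∘ τ) v
  subV-subV σ τ (var x) = refl
  subV-subV σ τ (lam t) =
    cong lam (trans (subT-subT (exts σ) (exts τ) t) (subT-cong (subV-exts-exts σ τ) t))

  subT-subT : ∀ σ τ t → subT σ (subT τ t) ≡ subT (subV σ ∘ τ) t
  subT-subT σ τ (val v)   = cong val (subV-subV σ τ v)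
  subT-subT σ τ (app t v) = cong₂ app (subT-subT σ τ t) (subV-subV σ τ v)

exts-var : exts var ≗ var
exts-var zero    = refl
exts-var (suc x) = refl

mutual
  subV-var : ∀ v → subV var v ≡ v
  subV-var (var x) = refl
  subV-var (lam t) = cong lam (trans (subT-cong exts-var t) (subT-var t))

  subT-var : ∀ t → subT var t ≡ t
  subT-var (val v)   = cong val (subV-var v)
  subT-var (app t v) = cong₂ app (subT-var t) (subV-var v)

-- Scope is measured with the boolean _<ᵇ_ so that it computes: for a concrete
-- term, a proof of scopedness is a nest of tt's.
mutual
  ScopedV : ℕ → Val → Set
  ScopedV k (var x) = T (x <ᵇ k)
  ScopedV k (lam t) = ScopedT (suc k) t

  ScopedT : ℕ → Tm → Set
  ScopedT k (val v)   = ScopedV k v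
  ScopedT k (app t v) = ScopedT k t × ScopedV k v

Closed : Val → Set
Closed = ScopedV 0

mutual
  subV-scoped : ∀ {k σ} → (∀ x → T (x <ᵇ k) → σ x ≡ var x) →
                ∀ v → ScopedV k v → subV σ v ≡ v
  subV-scoped h (var x) c = h x c
  subV-scoped h (lam t) c = cong lam (subT-scoped (exts-fixes h) t c)
    where
    exts-fixes : ∀ {k σ} → (∀ x → T (x <ᵇ k) → σ x ≡ var x) →
                 ∀ x → T (x <ᵇ suc k) → exts σ x ≡ var x
    exts-fixes h zero    _ = refl
    exts-fixes h (suc x) p = cong (renV suc) (h x p)

  subT-scoped : ∀ {k σ} → (∀ x → T (x <ᵇ k) → σ x ≡ var x) →
                ∀ t → ScopedT k t → subT σ t ≡ t
  subT-scoped h (val v)   c       = cong val (subV-scoped h v c)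
  subT-scoped h (app t v) (c , d) = cong₂ app (subT-scoped h t c) (subV-scoped h v d)

mutual
  renV-scoped : ∀ {k ρ} → (∀ x → T (x <ᵇ k) → ρ x ≡ x) →
                ∀ v → ScopedV k v → renV ρ v ≡ v
  renV-scoped h (var x) c = cong var (h x c)
  renV-scoped h (lam t) c = cong lam (renT-scoped (ext-fixes h) t c)
    where
    ext-fixes : ∀ {k ρ} → (∀ x → T (x <ᵇ k) → ρ x ≡ x) →
                ∀ x → T (x <ᵇ suc k) → ext ρ x ≡ x
    ext-fixes h zero    _ = refl
    ext-fixes h (suc x) p = cong suc (h x p)

  renT-scoped : ∀ {k ρ} → (∀ x → T (x <ᵇ k) → ρ x ≡ x) →
                ∀ t → ScopedT k t → renT ρ t ≡ t
  renT-scoped h (val v)   c       = cong val (renV-scoped h v c)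
  renT-scoped h (app t v) (c , d) = cong₂ app (renT-scoped h t c) (renV-scoped h v d)

subV-closed : ∀ σ {v} → Closed v → subV σ v ≡ v
subV-closed σ {v} = subV-scoped (λ x ()) v

renV-closed : ∀ ρ {v} → Closed v → renV ρ v ≡ v
renV-closed ρ {v} = renV-scoped (λ x ()) v

mutual
  ScopedV-mono : ∀ {k k′} → k ≤ k′ → ∀ v → ScopedV k v → ScopedV k′ v
  ScopedV-mono {k} le (var x) c = <⇒<ᵇ (≤-trans (<ᵇ⇒< x k c) le)
  ScopedV-mono     le (lam t) c = ScopedT-mono (s≤s le) t c

  ScopedT-mono : ∀ {k k′} → k ≤ k′ → ∀ t → ScopedT k t → ScopedT k′ t
  ScopedT-mono le (val v)   c       = ScopedV-mono le v c
  ScopedT-mono le (app t v) (c , d) = ScopedT-mono le t c , ScopedV-mono le v d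

Closed⇒ScopedV : ∀ {k v} → Closed v → ScopedV k v
Closed⇒ScopedV {v = v} = ScopedV-mono z≤n v

ScopedT-lams : ∀ K k t → ScopedT (K + k) t → ScopedT k (lams K t)
ScopedT-lams zero    k t c = c
ScopedT-lams (suc K) k t c =
  ScopedT-lams K (suc k) t (subst (λ z → ScopedT z t) (sym (+-suc K k)) c)

apps : Tm → List Val → Tm
apps t []       = t
apps t (v ∷ vs) = apps (app t v) vs

infix 21 _·_
_·_ : Val → List Val → Tm
v · vs = apps (val v) vs

apps-++ : ∀ t xs ys → apps t (xs ++ ys) ≡ apps (apps t xs) ys
apps-++ t []       ys = refl
apps-++ t (x ∷ xs) ys = apps-++ (app t x) xs ys

subT-apps : ∀ σ t vs → subT σ (apps t vs) ≡ apps (subT σ t) (map (subV σ) vs)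
subT-apps σ t []       = refl
subT-apps σ t (v ∷ vs) = subT-apps σ (app t v) vs

ScopedT-apps : ∀ {k} t vs → ScopedT k t → All (ScopedV k) vs → ScopedT k (apps t vs)
ScopedT-apps t []       c []       = c
ScopedT-apps t (v ∷ vs) c (d ∷ ds) = ScopedT-apps (app t v) vs (c , d) ds

map-subV-closed : ∀ σ {vs} → All Closed vs → map (subV σ) vs ≡ vs
map-subV-closed σ []       = refl
map-subV-closed σ (c ∷ cs) = cong₂ _∷_ (subV-closed σ c) (map-subV-closed σ cs)

subT-apps-closed-++ : ∀ σ t {us} → All Closed us → ∀ vs →
  subT σ (apps t (us ++ vs)) ≡ apps (subT σ t) (us ++ map (subV σ) vs)
subT-apps-closed-++ σ t {us} cs vs = begin
  subT σ (apps t (us ++ vs))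
    ≡⟨ subT-apps σ t (us ++ vs) ⟩
  apps (subT σ t) (map (subV σ) (us ++ vs))
    ≡⟨ cong (apps (subT σ t)) (map-++ (subV σ) us vs) ⟩
  apps (subT σ t) (map (subV σ) us ++ map (subV σ) vs)
    ≡⟨ cong (λ ws → apps (subT σ t) (ws ++ map (subV σ) vs)) (map-subV-closed σ cs) ⟩
  apps (subT σ t) (us ++ map (subV σ) vs) ∎

infixr 5 _◅◅_ _◅◅≤_
_◅◅_ : ∀ {t u w i j} → t ⟶det[ i ] u → u ⟶det[ j ] w → t ⟶det[ i + j ] w
done     ◅◅ r′ = r′
more s r ◅◅ r′ = more s (r ◅◅ r′)

_◅◅≤_ : ∀ {t u w i c} → t ⟶det[ i ] u → u ⟶det≤[ c ] w → t ⟶det≤[ i + c ] w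
_◅◅≤_ {i = i} r (j , j≤c , r′) = i + j , +-monoʳ-≤ i j≤c , r ◅◅ r′

at-most : ∀ {t u j c} → t ⟶det[ j ] u → j ≤ c → t ⟶det≤[ c ] u
at-most {j = j} r j≤c = j , j≤c , r

cast-target : ∀ {t u u′ j} → t ⟶det[ j ] u → u ≡ u′ → t ⟶det[ j ] u′
cast-target r refl = r

cast-source : ∀ {t t′ u j} → t ≡ t′ → t′ ⟶det[ j ] u → t ⟶det[ j ] u
cast-source refl r = r

apps-⟶ : ∀ {t u} vs → t ⟶det u → apps t vs ⟶det apps u vs
apps-⟶ []       s = s
apps-⟶ (v ∷ vs) s = apps-⟶ vs (ctx s)

apps-⟶[] : ∀ {t u j} vs → t ⟶det[ j ] u → apps t vs ⟶det[ j ] apps u vs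
apps-⟶[] vs done       = done
apps-⟶[] vs (more s r) = more (apps-⟶ vs s) (apps-⟶[] vs r)

extsⁿ : ℕ → (ℕ → Val) → ℕ → Val
extsⁿ zero    σ = σ
extsⁿ (suc K) σ = extsⁿ K (exts σ)

extsⁿ-suc : ∀ K σ x → extsⁿ (suc K) σ x ≡ exts (extsⁿ K σ) x
extsⁿ-suc zero    σ x = refl
extsⁿ-suc (suc K) σ x = extsⁿ-suc K (exts σ) x

subT-lams : ∀ K σ b → subT σ (lams K b) ≡ lams K (subT (extsⁿ K σ) b)
subT-lams zero    σ b = refl
subT-lams (suc K) σ b = cong (val ∘ lam) (subT-lams K (exts σ) b)

extsⁿ-bound : ∀ K σ x → T (x <ᵇ K) → extsⁿ K σ x ≡ var x
extsⁿ-bound (suc K) σ zero    p = extsⁿ-suc K σ zero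
extsⁿ-bound (suc K) σ (suc x) p =
  trans (extsⁿ-suc K σ (suc x)) (cong (renV suc) (extsⁿ-bound K σ x p))

extsⁿ-free : ∀ K σ y → Closed (σ y) → extsⁿ K σ (K + y) ≡ σ y
extsⁿ-free zero    σ y c = refl
extsⁿ-free (suc K) σ y c = begin
  extsⁿ (suc K) σ (suc (K + y))   ≡⟨ extsⁿ-suc K σ (suc (K + y)) ⟩
  renV suc (extsⁿ K σ (K + y))    ≡⟨ cong (renV suc) (extsⁿ-free K σ y c) ⟩
  renV suc (σ y)                  ≡⟨ renV-closed suc c ⟩
  σ y                             ∎

env : List Val → ℕ → Val
env []       x       = var x
env (v ∷ rs) zero    = v
env (v ∷ rs) (suc x) = env rs x

subV-env-extsⁿ : ∀ rs v x →
  subV (env rs) (extsⁿ (length rs) (single v) x) ≡ env (rs ∷ʳ v) x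
subV-env-extsⁿ []       v zero    = subV-var v
subV-env-extsⁿ []       v (suc x) = refl
subV-env-extsⁿ (r ∷ rs) v zero    =
  cong (subV (env (r ∷ rs))) (extsⁿ-suc (length rs) (single v) zero)
subV-env-extsⁿ (r ∷ rs) v (suc x) = begin
  subV (env (r ∷ rs)) (extsⁿ (suc (length rs)) (single v) (suc x))
    ≡⟨ cong (subV (env (r ∷ rs))) (extsⁿ-suc (length rs) (single v) (suc x)) ⟩
  subV (env (r ∷ rs)) (renV suc (extsⁿ (length rs) (single v) x))
    ≡⟨ subV-renV (env (r ∷ rs)) suc (extsⁿ (length rs) (single v) x) ⟩
  subV (env rs) (extsⁿ (length rs) (single v) x)
    ≡⟨ subV-env-extsⁿ rs v x ⟩
  env (rs ∷ʳ v) x ∎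

subT-env-extsⁿ : ∀ vs v b →
  subT (env (reverse vs)) (subT (extsⁿ (length vs) (single v)) b) ≡ subT (env (reverse (v ∷ vs))) b
subT-env-extsⁿ vs v b = begin
  subT (env (reverse vs)) (subT (extsⁿ (length vs) (single v)) b)
    ≡⟨ subT-subT _ _ b ⟩
  subT (subV (env (reverse vs)) ∘ extsⁿ (length vs) (single v)) b
    ≡⟨ subT-cong pointwise b ⟩
  subT (env (reverse vs ∷ʳ v)) b
    ≡⟨ cong (λ rs → subT (env rs) b) (unfold-reverse v vs) ⟨
  subT (env (reverse (v ∷ vs))) b ∎
  where
  pointwise : subV (env (reverse vs)) ∘ extsⁿ (length vs) (single v) ≗ env (reverse vs ∷ʳ v)
  pointwise x = trans (cong (λ K → subV (env (reverse vs)) (extsⁿ K (single v) x)) (sym (length-reverse vs)))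
                      (subV-env-extsⁿ (reverse vs) v x)

β-lams : ∀ vs b → apps (lams (length vs) b) vs ⟶det[ length vs ] subT (env (reverse vs)) b
β-lams []       b = cast-target done (sym (subT-var b))
β-lams (v ∷ vs) b =
  more (apps-⟶ vs β)
    (cast-source (cong (λ t → apps t vs) (subT-lams (length vs) (single v) b))
      (cast-target (β-lams vs _) (subT-env-extsⁿ vs v b)))

β-lams-to : ∀ {K u} vs b → length vs ≡ K → subT (env (reverse vs)) b ≡ u →
            apps (lams K b) vs ⟶det[ K ] u
β-lams-to vs b refl eq = cast-target (β-lams vs b) eq

env-snoc-last : ∀ rs v → env (rs ∷ʳ v) (length rs) ≡ v
env-snoc-last []       v = refl
env-snoc-last (r ∷ rs) v = env-snoc-last rs v

env-snoc-< : ∀ rs v x → x < length rs → env (rs ∷ʳ v) x ≡ env rs x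
env-snoc-< (r ∷ rs) v zero    p       = refl
env-snoc-< (r ∷ rs) v (suc x) (s≤s p) = env-snoc-< rs v x p

length-reverse-tabulate : ∀ {K} (f : Fin K → Val) → length (reverse (tabulate f)) ≡ K
length-reverse-tabulate f = trans (length-reverse (tabulate f)) (length-tabulate f)

env-reverse-tabulate : ∀ N (f : Fin (suc N) → Val) i → env (reverse (tabulate f)) (N ∸ toℕ i) ≡ f i
env-reverse-tabulate N f fzero = begin
  env (reverse (tabulate f)) N
    ≡⟨ cong (λ rs → env rs N) (unfold-reverse (f fzero) (tabulate (f ∘ fsuc))) ⟩
  env (reverse (tabulate (f ∘ fsuc)) ∷ʳ f fzero) N
    ≡⟨ cong (env (reverse (tabulate (f ∘ fsuc)) ∷ʳ f fzero)) (length-reverse-tabulate (f ∘ fsuc)) ⟨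
  env (reverse (tabulate (f ∘ fsuc)) ∷ʳ f fzero) (length (reverse (tabulate (f ∘ fsuc))))
    ≡⟨ env-snoc-last (reverse (tabulate (f ∘ fsuc))) (f fzero) ⟩
  f fzero ∎
env-reverse-tabulate (suc N) f (fsuc i) = begin
  env (reverse (tabulate f)) (N ∸ toℕ i)
    ≡⟨ cong (λ rs → env rs (N ∸ toℕ i)) (unfold-reverse (f fzero) (tabulate (f ∘ fsuc))) ⟩
  env (reverse (tabulate (f ∘ fsuc)) ∷ʳ f fzero) (N ∸ toℕ i)
    ≡⟨ env-snoc-< (reverse (tabulate (f ∘ fsuc))) (f fzero) (N ∸ toℕ i) in-range ⟩
  env (reverse (tabulate (f ∘ fsuc))) (N ∸ toℕ i)
    ≡⟨ env-reverse-tabulate N (f ∘ fsuc) i ⟩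
  f (fsuc i) ∎
  where
  in-range : N ∸ toℕ i < length (reverse (tabulate (f ∘ fsuc)))
  in-range = subst (N ∸ toℕ i <_) (sym (length-reverse-tabulate (f ∘ fsuc))) (s≤s (m∸n≤m N (toℕ i)))

≤⇒<ᵇ+suc : ∀ {x} K k → x ≤ K → T (x <ᵇ K + suc k)
≤⇒<ᵇ+suc K k x≤K = <⇒<ᵇ (≤-<-trans x≤K (m<m+n K (s≤s z≤n)))

encSym-closed : ∀ {K} (i : Fin K) → Closed (encSym i)
encSym-closed {suc K} i = ScopedT-lams K 1 _ (≤⇒<ᵇ+suc K 0 (m∸n≤m K (toℕ i)))

encStr-closed : ∀ {K} (r : List (Fin K)) → Closed (encStr r)
encStr-closed {K} []      = ScopedT-lams K 1 _ (≤⇒<ᵇ+suc K 0 z≤n)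
encStr-closed {K} (i ∷ r) = ScopedT-lams K 1 _
  (≤⇒<ᵇ+suc K 0 (m∸n≤m K (toℕ i)) , Closed⇒ScopedV {v = encStr r} (encStr-closed r))

encSym-scoped : ∀ {k K} (i : Fin K) → ScopedV k (encSym i)
encSym-scoped i = Closed⇒ScopedV {v = encSym i} (encSym-closed i)

encStr-scoped : ∀ {k K} (r : List (Fin K)) → ScopedV k (encStr r)
encStr-scoped r = Closed⇒ScopedV {v = encStr r} (encStr-closed r)

encSym-selects : ∀ {K} (f : Fin K → Val) i rest → encSym i · (tabulate f ++ rest) ⟶det[ K ] f i · rest
encSym-selects {suc N} f i rest =
  cast-source (apps-++ _ (tabulate f) rest)
    (apps-⟶[] rest (β-lams-to (tabulate f) _ (length-tabulate f) (cong val (env-reverse-tabulate N f i))))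

length-tabulate-∷ʳ : ∀ {K} (f : Fin K → Val) e → length (tabulate f ∷ʳ e) ≡ suc K
length-tabulate-∷ʳ {K} f e =
  trans (length-++ (tabulate f)) (trans (cong (_+ 1) (length-tabulate f)) (+-comm K 1))

apps-tabulate-∷ʳ : ∀ {K} t (f : Fin K → Val) e rest →
                   apps t (tabulate f ++ e ∷ rest) ≡ apps (apps t (tabulate f ∷ʳ e)) rest
apps-tabulate-∷ʳ t f e rest =
  trans (cong (apps t) (sym (++-assoc (tabulate f) (e ∷ []) rest))) (apps-++ t (tabulate f ∷ʳ e) rest)

encStr-∷-selects : ∀ {N} (f : Fin (suc N) → Val) e a r rest →
  encStr (a ∷ r) · (tabulate f ++ e ∷ rest) ⟶det[ suc (suc N) ] f a · (encStr r ∷ rest)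
encStr-∷-selects {N} f e a r rest =
  cast-source (apps-tabulate-∷ʳ _ f e rest)
    (apps-⟶[] rest (β-lams-to (tabulate f ∷ʳ e) _ (length-tabulate-∷ʳ f e)
      (cong₂ (λ x y → app (val x) y) handler (subV-closed _ (encStr-closed r)))))
  where
  handler : env (reverse (tabulate f ∷ʳ e)) (suc N ∸ toℕ a) ≡ f a
  handler = begin
    env (reverse (tabulate f ∷ʳ e)) (suc N ∸ toℕ a)
      ≡⟨ cong (λ rs → env rs (suc N ∸ toℕ a)) (reverse-++ (tabulate f) (e ∷ [])) ⟩
    env (e ∷ reverse (tabulate f)) (suc N ∸ toℕ a)
      ≡⟨ cong (env (e ∷ reverse (tabulate f))) (+-∸-assoc 1 (toℕ≤pred[n] a)) ⟩
    env (reverse (tabulate f)) (N ∸ toℕ a)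
      ≡⟨ env-reverse-tabulate N f a ⟩
    f a ∎

encStr-[]-selects : ∀ {N} (f : Fin N → Val) e rest →
  encStr {N} [] · (tabulate f ++ e ∷ rest) ⟶det[ suc N ] e · rest
encStr-[]-selects f e rest =
  cast-source (apps-tabulate-∷ʳ _ f e rest)
    (apps-⟶[] rest (β-lams-to (tabulate f ∷ʳ e) _ (length-tabulate-∷ʳ f e)
      (cong (λ rs → val (env rs 0)) (reverse-++ (tabulate f) (e ∷ [])))))

conf : Val → Val → Val → Val → Val
conf s a r q = lam (var 0 · (s ∷ a ∷ r ∷ q ∷ []))

conf-cong : ∀ {s a r q s′ a′ r′ q′} → s ≡ s′ → a ≡ a′ → r ≡ r′ → q ≡ q′ →
            conf s a r q ≡ conf s′ a′ r′ q′
conf-cong refl refl refl refl = refl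

reverse-∷ʳ : ∀ {A : Set} (xs : List A) x → reverse (xs ∷ʳ x) ≡ x ∷ reverse xs
reverse-∷ʳ xs x = reverse-++ xs (x ∷ [])

-- In named notation, writing ⌜s,a,r,q⌝ for conf ⌜sʳ⌝ ⌜a⌝ ⌜r⌝ ⌜q⌝:
--   transTm        = rec rec
--   rec            = λA k c. c dispatch A k
--   dispatch       = λs a r q A k. q (onState q₁) … (onState qₘ) s a r A k
--   onState q_fin  = λs a r A k. k ⌜s,a,r,q_fin⌝
--   onState q      = λs a r A k. a (act (δ q b₁)) … (act (δ q □)) s r A k
--   act (l,h,↓)    = λs r A k. A A k ⌜s,h,r,l⌝
--   act (l,h,→)    = λs r A k. r (moveR h l b₁) … (moveR h l □) (moveR-end h l) s A k
--   moveR h l b    = λp s A k. A A k ⌜s h,b,p,l⌝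
--   moveR-end h l  = λs A k. A A k ⌜s h,□,ε,l⌝
-- and symmetrically for ←.
module Interpreter (M : TM) where
  open TM M

  N : ℕ
  N = suc n

  ⌜_⌝* : List Sym → Val
  ⌜_⌝* = encStr

  ⌜_⌝ˡ : List Sym → Val
  ⌜ s ⌝ˡ = ⌜ reverse s ⌝*

  ⌜_⌝ : Config → Val
  ⌜_⌝ = encConf M

  -- The cons clause of encStr with the encoded tail as a parameter.
  push : Sym → Val → Val
  push h w = lam (lams N (app (val (var (N ∸ toℕ h))) w))

  -- push h applied to the variable y of the context outside push's N+1 binders
  pushVar : Sym → ℕ → Val
  pushVar h y = push h (var (suc N + y))

  pushVar-scoped : ∀ h y k → T (y <ᵇ k) → ScopedV k (pushVar h y)
  pushVar-scoped h y k y<k = ScopedT-lams N (suc k) _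
    ( ≤⇒<ᵇ+suc N k (m∸n≤m N (toℕ h))
    , <⇒<ᵇ (subst (suc (N + y) <_) (sym (+-suc N k)) (s≤s (+-monoʳ-< N (<ᵇ⇒< y k y<k)))))

  subV-pushVar : ∀ σ h y {v} → σ y ≡ v → Closed v → subV σ (pushVar h y) ≡ push h v
  subV-pushVar σ h y refl c = cong lam (begin
    subT (exts σ) (lams N (app (val (var (N ∸ toℕ h))) (var (suc N + y))))
      ≡⟨ subT-lams N (exts σ) _ ⟩
    lams N (app (val (extsⁿ (suc N) σ (N ∸ toℕ h))) (extsⁿ (suc N) σ (suc N + y)))
      ≡⟨ cong (lams N) (cong₂ app (cong val (extsⁿ-bound (suc N) σ (N ∸ toℕ h) h-bound))
                                  (extsⁿ-free (suc N) σ y c)) ⟩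
    lams N (app (val (var (N ∸ toℕ h))) (σ y)) ∎)
    where
    h-bound : T (N ∸ toℕ h <ᵇ suc N)
    h-bound = <⇒<ᵇ (s≤s (m∸n≤m N (toℕ h)))

  moveR : Sym → Fin m → Sym → Val
  moveR h l b =
    lam (lams 3 (var 1 · (var 1 ∷ var 0 ∷ conf (pushVar h 3) (encSym b) (var 4) (encSym l) ∷ [])))

  moveR-end : Sym → Fin m → Val
  moveR-end h l =
    lam (lams 2 (var 1 · (var 1 ∷ var 0 ∷ conf (pushVar h 3) (encSym □) ⌜ [] ⌝* (encSym l) ∷ [])))

  moveL : Sym → Fin m → Sym → Val
  moveL h l b =
    lam (lams 3 (var 1 · (var 1 ∷ var 0 ∷ conf (var 4) (encSym b) (pushVar h 3) (encSym l) ∷ [])))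

  moveL-end : Sym → Fin m → Val
  moveL-end h l =
    lam (lams 2 (var 1 · (var 1 ∷ var 0 ∷ conf ⌜ [] ⌝* (encSym □) (pushVar h 3) (encSym l) ∷ [])))

  act : Fin m × Sym × Dir → Val
  act (l , h , S) =
    lam (lams 3 (var 1 · (var 1 ∷ var 0 ∷ conf (var 4) (encSym h) (var 3) (encSym l) ∷ [])))
  act (l , h , R) =
    lam (lams 3 (var 2 · (tabulate (moveR h l) ++ moveR-end h l ∷ var 3 ∷ var 1 ∷ var 0 ∷ [])))
  act (l , h , L) =
    lam (lams 3 (var 3 · (tabulate (moveL h l) ++ moveL-end h l ∷ var 2 ∷ var 1 ∷ var 0 ∷ [])))

  halt : Val
  halt = lam (lams 4 (app (val (var 0)) (conf (var 5) (var 4) (var 3) (encSym qfin))))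

  onSymbol : (q : Fin m) → .(q ≢ qfin) → Val
  onSymbol q q≢qfin =
    lam (lams 4 (var 3 · (tabulate (λ a → act (δ q q≢qfin a))
                          ++ var 4 ∷ var 2 ∷ var 1 ∷ var 0 ∷ [])))

  onState : Fin m → Val
  onState q with q ≟ qfin
  ... | yes _      = halt
  ... | no q≢qfin = onSymbol q q≢qfin

  dispatch : Val
  dispatch = lam (lams 5 (var 2 · (tabulate onState ++ var 5 ∷ var 4 ∷ var 3 ∷ var 1 ∷ var 0 ∷ [])))

  rec : Val
  rec = lam (lams 2 (var 0 · (dispatch ∷ var 2 ∷ var 1 ∷ [])))

  transTm : Tm
  transTm = app (val rec) rec

  moveR-closed : ∀ h l b → Closed (moveR h l b)
  moveR-closed h l b =
    ((tt , tt) , tt) , (((tt , pushVar-scoped h 3 5 tt) , encSym-scoped b) , tt) , encSym-scoped l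

  moveR-end-closed : ∀ h l → Closed (moveR-end h l)
  moveR-end-closed h l =
    ((tt , tt) , tt) ,
    (((tt , pushVar-scoped h 3 4 tt) , encSym-scoped □) , encStr-scoped {K = N} []) , encSym-scoped l

  moveL-closed : ∀ h l b → Closed (moveL h l b)
  moveL-closed h l b =
    ((tt , tt) , tt) , (((tt , tt) , encSym-scoped b) , pushVar-scoped h 3 5 tt) , encSym-scoped l

  moveL-end-closed : ∀ h l → Closed (moveL-end h l)
  moveL-end-closed h l =
    ((tt , tt) , tt) ,
    (((tt , encStr-scoped {K = N} []) , encSym-scoped □) , pushVar-scoped h 3 4 tt) , encSym-scoped l

  act-closed : ∀ x → Closed (act x)
  act-closed (l , h , S) = ((tt , tt) , tt) , (((tt , tt) , encSym-scoped h) , tt) , encSym-scoped l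
  act-closed (l , h , R) = ScopedT-apps (val (var 2)) _ tt
    (++⁺ (tabulate⁺ {f = moveR h l} (λ b → Closed⇒ScopedV {v = moveR h l b} (moveR-closed h l b)))
         (Closed⇒ScopedV {v = moveR-end h l} (moveR-end-closed h l) ∷ tt ∷ tt ∷ tt ∷ []))
  act-closed (l , h , L) = ScopedT-apps (val (var 3)) _ tt
    (++⁺ (tabulate⁺ {f = moveL h l} (λ b → Closed⇒ScopedV {v = moveL h l b} (moveL-closed h l b)))
         (Closed⇒ScopedV {v = moveL-end h l} (moveL-end-closed h l) ∷ tt ∷ tt ∷ tt ∷ []))

  onState-closed : ∀ q → Closed (onState q)
  onState-closed q with q ≟ qfin
  ... | yes _      = tt , (((tt , tt) , tt) , tt) , encSym-scoped qfin
  ... | no q≢qfin = ScopedT-apps (val (var 3)) _ tt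
    (++⁺ (tabulate⁺ {f = λ a → act (δ q q≢qfin a)}
                    (λ a → Closed⇒ScopedV {v = act (δ q q≢qfin a)} (act-closed (δ q q≢qfin a))))
         (tt ∷ tt ∷ tt ∷ tt ∷ []))

  dispatch-closed : Closed dispatch
  dispatch-closed = ScopedT-apps (val (var 2)) _ tt
    (++⁺ (tabulate⁺ {f = onState} (λ q → Closed⇒ScopedV {v = onState q} (onState-closed q)))
         (tt ∷ tt ∷ tt ∷ tt ∷ tt ∷ []))

  onState-qfin : onState qfin ≡ halt
  onState-qfin with qfin ≟ qfin
  ... | yes _      = refl
  ... | no q≢qfin = ⊥-elim (q≢qfin refl)

  onState-nonfinal : ∀ q .(q≢qfin : q ≢ qfin) → onState q ≡ onSymbol q q≢qfin
  onState-nonfinal q q≢qfin with q ≟ qfin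
  ... | yes q≡qfin = ⊥-elim-irr (q≢qfin q≡qfin)
  ... | no _       = refl

  rec-unfolds : ∀ k {s a r q} → Closed s → Closed a → Closed r → Closed q →
    app (app transTm k) (conf s a r q) ⟶det[ 3 + 1 ] dispatch · (s ∷ a ∷ r ∷ q ∷ rec ∷ k ∷ [])
  rec-unfolds k {s} {a} {r} {q} cs ca cr cq =
    β-lams-to (rec ∷ k ∷ conf s a r q ∷ []) _ refl
      (cong (λ d → conf s a r q · (d ∷ rec ∷ k ∷ [])) (subV-closed _ dispatch-closed))
    ◅◅ apps-⟶[] (rec ∷ k ∷ []) (β-lams-to (dispatch ∷ []) _ refl
      (cong (dispatch ·_) (map-subV-closed _ (cs ∷ ca ∷ cr ∷ cq ∷ []))))

  state-selected : ∀ k s a r q →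
    dispatch · (s ∷ a ∷ r ∷ encSym q ∷ rec ∷ k ∷ []) ⟶det[ 6 + m ]
    onState q · (s ∷ a ∷ r ∷ rec ∷ k ∷ [])
  state-selected k s a r q =
    β-lams-to (s ∷ a ∷ r ∷ encSym q ∷ rec ∷ k ∷ []) _ refl
      (subT-apps-closed-++ _ (val (var 2)) (tabulate⁺ {f = onState} onState-closed) _)
    ◅◅ encSym-selects onState q (s ∷ a ∷ r ∷ rec ∷ k ∷ [])

  symbol-selected : ∀ k s r q .(q≢qfin : q ≢ qfin) a →
    onSymbol q q≢qfin · (s ∷ encSym a ∷ r ∷ rec ∷ k ∷ []) ⟶det[ 5 + N ]
    act (δ q q≢qfin a) · (s ∷ r ∷ rec ∷ k ∷ [])
  symbol-selected k s r q q≢qfin a =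
    β-lams-to (s ∷ encSym a ∷ r ∷ rec ∷ k ∷ []) _ refl
      (subT-apps-closed-++ _ (val (var 3))
         (tabulate⁺ {f = λ b → act (δ q q≢qfin b)} (λ b → act-closed (δ q q≢qfin b))) _)
    ◅◅ encSym-selects (λ b → act (δ q q≢qfin b)) a (s ∷ r ∷ rec ∷ k ∷ [])

  halt-reduces : ∀ k s a r →
    halt · (⌜ s ⌝ˡ ∷ encSym a ∷ ⌜ r ⌝* ∷ rec ∷ k ∷ []) ⟶det[ 5 ]
    app (val k) ⌜ ⟨ s , a , r , qfin ⟩ ⌝
  halt-reduces k s a r =
    β-lams-to (⌜ s ⌝ˡ ∷ encSym a ∷ ⌜ r ⌝* ∷ rec ∷ k ∷ []) _ refl
      (cong (app (val k)) (conf-cong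
        (renV-closed suc (encStr-closed (reverse s))) (renV-closed suc (encSym-closed a))
        (renV-closed suc (encStr-closed r))           (subV-closed _ (encSym-closed qfin))))

  stay-reduces : ∀ k l h s r →
    act (l , h , S) · (⌜ s ⌝ˡ ∷ ⌜ r ⌝* ∷ rec ∷ k ∷ []) ⟶det[ 4 ]
    app (app transTm k) ⌜ ⟨ s , h , r , l ⟩ ⌝
  stay-reduces k l h s r =
    β-lams-to (⌜ s ⌝ˡ ∷ ⌜ r ⌝* ∷ rec ∷ k ∷ []) _ refl
      (cong (app (app transTm k)) (conf-cong
        (renV-closed suc (encStr-closed (reverse s))) (subV-closed _ (encSym-closed h))
        (renV-closed suc (encStr-closed r)) (subV-closed _ (encSym-closed l))))

  right-reads : ∀ k l h sv rv →
    act (l , h , R) · (sv ∷ rv ∷ rec ∷ k ∷ []) ⟶det[ 4 ]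
    rv · (tabulate (moveR h l) ++ moveR-end h l ∷ sv ∷ rec ∷ k ∷ [])
  right-reads k l h sv rv =
    β-lams-to (sv ∷ rv ∷ rec ∷ k ∷ []) _ refl
      (trans (subT-apps-closed-++ _ (val (var 2)) (tabulate⁺ {f = moveR h l} (moveR-closed h l)) _)
             (cong (λ e → rv · (tabulate (moveR h l) ++ e ∷ sv ∷ rec ∷ k ∷ []))
                   (subV-closed _ (moveR-end-closed h l))))

  left-reads : ∀ k l h sv rv →
    act (l , h , L) · (sv ∷ rv ∷ rec ∷ k ∷ []) ⟶det[ 4 ]
    sv · (tabulate (moveL h l) ++ moveL-end h l ∷ rv ∷ rec ∷ k ∷ [])
  left-reads k l h sv rv =
    β-lams-to (sv ∷ rv ∷ rec ∷ k ∷ []) _ refl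
      (trans (subT-apps-closed-++ _ (val (var 3)) (tabulate⁺ {f = moveL h l} (moveL-closed h l)) _)
             (cong (λ e → sv · (tabulate (moveL h l) ++ e ∷ rv ∷ rec ∷ k ∷ []))
                   (subV-closed _ (moveL-end-closed h l))))

  pushVar-left : ∀ σ h s → σ 3 ≡ renV suc ⌜ s ⌝ˡ → subV σ (pushVar h 3) ≡ ⌜ s ∷ʳ h ⌝ˡ
  pushVar-left σ h s eq = begin
    subV σ (pushVar h 3)
      ≡⟨ subV-pushVar σ h 3 (trans eq (renV-closed suc (encStr-closed (reverse s)))) (encStr-closed (reverse s)) ⟩
    ⌜ h ∷ reverse s ⌝*
      ≡⟨ cong ⌜_⌝* (reverse-∷ʳ s h) ⟨
    ⌜ s ∷ʳ h ⌝ˡ ∎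

  pushVar-right : ∀ σ h r → σ 3 ≡ renV suc ⌜ r ⌝* → subV σ (pushVar h 3) ≡ ⌜ h ∷ r ⌝*
  pushVar-right σ h r eq =
    subV-pushVar σ h 3 (trans eq (renV-closed suc (encStr-closed r))) (encStr-closed r)

  moveR-reduces : ∀ k l h s b p →
    moveR h l b · (⌜ p ⌝* ∷ ⌜ s ⌝ˡ ∷ rec ∷ k ∷ []) ⟶det[ 4 ]
    app (app transTm k) ⌜ ⟨ s ∷ʳ h , b , p , l ⟩ ⌝
  moveR-reduces k l h s b p =
    β-lams-to (⌜ p ⌝* ∷ ⌜ s ⌝ˡ ∷ rec ∷ k ∷ []) _ refl
      (cong (app (app transTm k)) (conf-cong
        (pushVar-left _ h s refl) (subV-closed _ (encSym-closed b))
        (renV-closed suc (encStr-closed p)) (subV-closed _ (encSym-closed l))))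

  moveR-end-reduces : ∀ k l h s →
    moveR-end h l · (⌜ s ⌝ˡ ∷ rec ∷ k ∷ []) ⟶det[ 3 ]
    app (app transTm k) ⌜ ⟨ s ∷ʳ h , □ , [] , l ⟩ ⌝
  moveR-end-reduces k l h s =
    β-lams-to (⌜ s ⌝ˡ ∷ rec ∷ k ∷ []) _ refl
      (cong (app (app transTm k)) (conf-cong
        (pushVar-left _ h s refl) (subV-closed _ (encSym-closed □))
        (subV-closed _ (encStr-closed {N} [])) (subV-closed _ (encSym-closed l))))

  moveL-reduces : ∀ k l h b p r →
    moveL h l b · (⌜ p ⌝ˡ ∷ ⌜ r ⌝* ∷ rec ∷ k ∷ []) ⟶det[ 4 ]
    app (app transTm k) ⌜ ⟨ p , b , h ∷ r , l ⟩ ⌝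
  moveL-reduces k l h b p r =
    β-lams-to (⌜ p ⌝ˡ ∷ ⌜ r ⌝* ∷ rec ∷ k ∷ []) _ refl
      (cong (app (app transTm k)) (conf-cong
        (renV-closed suc (encStr-closed (reverse p))) (subV-closed _ (encSym-closed b))
        (pushVar-right _ h r refl) (subV-closed _ (encSym-closed l))))

  moveL-end-reduces : ∀ k l h r →
    moveL-end h l · (⌜ r ⌝* ∷ rec ∷ k ∷ []) ⟶det[ 3 ]
    app (app transTm k) ⌜ ⟨ [] , □ , h ∷ r , l ⟩ ⌝
  moveL-end-reduces k l h r =
    β-lams-to (⌜ r ⌝* ∷ rec ∷ k ∷ []) _ refl
      (cong (app (app transTm k)) (conf-cong
        (subV-closed _ (encStr-closed {N} [])) (subV-closed _ (encSym-closed □))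
        (pushVar-right _ h r refl) (subV-closed _ (encSym-closed l))))

  stateCost symbolCost moveCost bound : ℕ
  stateCost  = (3 + 1) + (6 + m)
  symbolCost = 5 + N
  moveCost   = 4 + (suc N + 4)
  bound      = stateCost + symbolCost + moveCost

  state-reached : ∀ k s a r q →
    app (app transTm k) ⌜ ⟨ s , a , r , q ⟩ ⌝ ⟶det[ stateCost ]
    onState q · (⌜ s ⌝ˡ ∷ encSym a ∷ ⌜ r ⌝* ∷ rec ∷ k ∷ [])
  state-reached k s a r q =
    rec-unfolds k (encStr-closed (reverse s)) (encSym-closed a) (encStr-closed r) (encSym-closed q)
    ◅◅ state-selected k ⌜ s ⌝ˡ (encSym a) ⌜ r ⌝* q

  action-reached : ∀ k s a r q .(q≢qfin : q ≢ qfin) {x} → δ q q≢qfin a ≡ x →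
    app (app transTm k) ⌜ ⟨ s , a , r , q ⟩ ⌝ ⟶det[ stateCost + symbolCost ]
    act x · (⌜ s ⌝ˡ ∷ ⌜ r ⌝* ∷ rec ∷ k ∷ [])
  action-reached k s a r q q≢qfin refl =
    cast-target (state-reached k s a r q)
      (cong (_· (⌜ s ⌝ˡ ∷ encSym a ∷ ⌜ r ⌝* ∷ rec ∷ k ∷ [])) (onState-nonfinal q q≢qfin))
    ◅◅ symbol-selected k ⌜ s ⌝ˡ ⌜ r ⌝* q q≢qfin a

  halts : ∀ k C → Config.state C ≡ qfin →
          app (app transTm k) ⌜ C ⌝ ⟶det≤[ bound ] app (val k) ⌜ C ⌝
  halts k ⟨ s , a , r , _ ⟩ refl = at-most
    (cast-target (state-reached k s a r qfin)
       (cong (_· (⌜ s ⌝ˡ ∷ encSym a ∷ ⌜ r ⌝* ∷ rec ∷ k ∷ [])) onState-qfin)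
     ◅◅ halt-reduces k s a r)
    (≤-trans (+-monoʳ-≤ stateCost (m≤m+n 5 N)) (m≤m+n _ moveCost))

  end-within-moveCost : 4 + (suc N + 3) ≤ moveCost
  end-within-moveCost = +-monoʳ-≤ 4 (+-monoʳ-≤ (suc N) (n≤1+n 3))

  right∷-reduces : ∀ k l h s b p →
    act (l , h , R) · (⌜ s ⌝ˡ ∷ ⌜ b ∷ p ⌝* ∷ rec ∷ k ∷ []) ⟶det≤[ moveCost ]
    app (app transTm k) ⌜ ⟨ s ∷ʳ h , b , p , l ⟩ ⌝
  right∷-reduces k l h s b p = at-most
    (right-reads k l h ⌜ s ⌝ˡ ⌜ b ∷ p ⌝*
     ◅◅ encStr-∷-selects (moveR h l) (moveR-end h l) b p (⌜ s ⌝ˡ ∷ rec ∷ k ∷ [])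
     ◅◅ moveR-reduces k l h s b p)
    ≤-refl

  right[]-reduces : ∀ k l h s →
    act (l , h , R) · (⌜ s ⌝ˡ ∷ ⌜ [] ⌝* ∷ rec ∷ k ∷ []) ⟶det≤[ moveCost ]
    app (app transTm k) ⌜ ⟨ s ∷ʳ h , □ , [] , l ⟩ ⌝
  right[]-reduces k l h s = at-most
    (right-reads k l h ⌜ s ⌝ˡ ⌜ [] ⌝*
     ◅◅ encStr-[]-selects (moveR h l) (moveR-end h l) (⌜ s ⌝ˡ ∷ rec ∷ k ∷ [])
     ◅◅ moveR-end-reduces k l h s)
    end-within-moveCost

  left∷-reduces : ∀ k l h p b r →
    act (l , h , L) · (⌜ p ∷ʳ b ⌝ˡ ∷ ⌜ r ⌝* ∷ rec ∷ k ∷ []) ⟶det≤[ moveCost ]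
    app (app transTm k) ⌜ ⟨ p , b , h ∷ r , l ⟩ ⌝
  left∷-reduces k l h p b r = at-most
    (cast-source (cong (λ t → act (l , h , L) · (⌜ t ⌝* ∷ ⌜ r ⌝* ∷ rec ∷ k ∷ []))
                       (reverse-∷ʳ p b))
      (left-reads k l h ⌜ b ∷ reverse p ⌝* ⌜ r ⌝*
       ◅◅ encStr-∷-selects (moveL h l) (moveL-end h l) b (reverse p) (⌜ r ⌝* ∷ rec ∷ k ∷ [])
       ◅◅ moveL-reduces k l h b p r))
    ≤-refl

  left[]-reduces : ∀ k l h r →
    act (l , h , L) · (⌜ [] ⌝ˡ ∷ ⌜ r ⌝* ∷ rec ∷ k ∷ []) ⟶det≤[ moveCost ]
    app (app transTm k) ⌜ ⟨ [] , □ , h ∷ r , l ⟩ ⌝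
  left[]-reduces k l h r = at-most
    (left-reads k l h ⌜ [] ⌝* ⌜ r ⌝*
     ◅◅ encStr-[]-selects (moveL h l) (moveL-end h l) (⌜ r ⌝* ∷ rec ∷ k ∷ [])
     ◅◅ moveL-end-reduces k l h r)
    end-within-moveCost

  steps : ∀ k {C D} → C →M D →
          app (app transTm k) ⌜ C ⌝ ⟶det≤[ bound ] app (app transTm k) ⌜ D ⌝
  steps k (stay {s} {a} {r} {q} {l} {h} q≢qfin eq) =
    action-reached k s a r q q≢qfin eq ◅◅≤ at-most (stay-reduces k l h s r) (m≤m+n 4 _)
  steps k (left∷ {p} {b} {a} {r} {q} {l} {h} q≢qfin eq) =
    action-reached k (p ∷ʳ b) a r q q≢qfin eq ◅◅≤ left∷-reduces k l h p b r
  steps k (left[] {a} {r} {q} {l} {h} q≢qfin eq) =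
    action-reached k [] a r q q≢qfin eq ◅◅≤ left[]-reduces k l h r
  steps k (right∷ {s} {a} {b} {p} {q} {l} {h} q≢qfin eq) =
    action-reached k s a (b ∷ p) q q≢qfin eq ◅◅≤ right∷-reduces k l h s b p
  steps k (right[] {s} {a} {q} {l} {h} q≢qfin eq) =
    action-reached k s a [] q q≢qfin eq ◅◅≤ right[]-reduces k l h s

open Interpreter

lemma7 : (M : TM) → Σ Tm λ trans → Σ ℕ λ c → (k : Val) → (C : TM.Config M) →
           ((TM.Config.state C ≡ TM.qfin M) →
              app (app trans k) (encConf M C) ⟶det≤[ c ] app (val k) (encConf M C))
           × ((D : TM.Config M) → TM._→M_ M C D →
              app (app trans k) (encConf M C) ⟶det≤[ c ] app (app trans k) (encConf M D))
lemma7 M = transTm M , bound M , λ k C → halts M k C , λ D → steps M k
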